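{- Let $k\ge 2$, $\underline{r}=(r_1,\ldots,r_k)\in\mathbb{R}^k$, let $(Z_n : NC^{\mathrm{(mton)}}(n)\to\mathbb{R})_{n\ge1}$ be recursive of the first kind with input $\underline{r}$, and let $L_n(t)=\sum_{(\pi,u)\in NC^{\mathrm{(mton)}}(n)} t^{Z_n(\pi,u)}$ for $t>0$. Then for every integer $m\ge2$ and $t\in(0,\infty)$, $$\sum_{\substack{(\rho,v)\in NC^{\mathrm{(mton)}}(m)\\ |J(\rho,v)|=1}} t^{Z_m(\rho,v)} = m\, t^{r_1}\, L_{m-1}(t).$$
   Context: $NC(n)$: non-crossing partitions of $\{1,\ldots,n\}$. For blocks $V,W$, "$V$ nested inside $W$" means $\min V>\min W$ and $\max V<\max W$. A monotonic ordering of $\pi\in NC(n)$ is a bijection $u:\pi\to\{1,\ldots,|\pi|\}$ with $u(V)>u(W)$ whenever $V$ is nested inside $W$; $NC^{\mathrm{(mton)}}(n)$ is the set of such pairs $(\pi,u)$. $J(\pi,u):=u^{ -1}(|\pi|)$ (an interval). For $n\ge2$, the parent $\mathfrak{p}(\pi,u)=(\rho,v)\in NC^{\mathrm{(mton)}}(n-1)$: with $m'=\max J(\pi,u)$ and $\phi$ the increasing bijection $\{1,\ldots,n\}\setminus\{m'\}\to\{1,\ldots,n-1\}$, $\rho=\{\phi(V\setminus\{m'\}) : V\in\pi, V\ne\{m'\}\}$ and $v(\phi(V\setminus\{m'\}))=u(V)$. $(Z_n)$ is recursive of the first kind with input $(r_1,\ldots,r_k)$ if for all $n\ge2$ and $(\pi,u)\in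 NC^{\mathrm{(mton)}}(n)$ with parent $(\rho,v)$: $Z_n(\pi,u)=Z_{n-1}(\rho,v)+r_j$ when $|J(\pi,u)|=j\le k$, and $Z_n(\pi,u)=Z_{n-1}(\rho,v)$ when $|J(\pi,u)|>k$. -}

module Defs where

open import Level using (Level)
open import Data.Nat as ℕ using (ℕ; zero; suc)
open import Data.Fin as F using (Fin; toℕ; punchOut)
open import Data.Fin.Properties using (_≟_; _≤?_; _<?_; all?; any?)
open import Data.Vec as V using (Vec; lookup)
open import Data.List as L using (List; []; _∷_; concatMap; allFin; upTo; length; filter; foldr)
open import Data.Product using (Σ; ∃; _×_; _,_)
open import Relation.Binary.PropositionalEquality using (_≡_; _≢_)
open import Relation.Nullary using (Dec; yes; no)
open import Relation.Nullary.Decidable using (_×-dec_; _→-dec_)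
open import Algebra.Bundles using (CommutativeSemiring)

-- A pair (π , u) ∈ NC^(mton)(n) with |π| = b is encoded by its labelling
-- lab : Vec (Fin b) n, where lab[i] = u(V) - 1 for the block V ∋ i
-- (labels 1..b are shifted to 0..b-1).  The blocks of π are the
-- (nonempty) fibres of lab, and u is the label of the fibre.

module _ {n b : ℕ} (f : Fin n → Fin b) where

  -- every label is used: the fibres are exactly the |π| = b blocks
  Surj : Set
  Surj = ∀ x → ∃ λ i → f i ≡ x

  NonCrossing : Set
  NonCrossing = ∀ a p c q → a F.< p → p F.< c → c F.< q →
                f a ≡ f c → f p ≡ f q → f a ≡ f p

  IsMinOf : Fin b → Fin n → Set
  IsMinOf x i = f i ≡ x × (∀ j → f j ≡ x → i F.≤ j)

  IsMaxOf : Fin b → Fin n → Set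
  IsMaxOf x i = f i ≡ x × (∀ j → f j ≡ x → j F.≤ i)

  NestedIn : Fin b → Fin b → Set
  NestedIn x y = ∀ iV iW jV jW → IsMinOf x iV → IsMinOf y iW →
                 IsMaxOf x jV → IsMaxOf y jW → (iW F.< iV × jV F.< jW)

  Monotonic : Set
  Monotonic = ∀ x y → NestedIn x y → y F.< x

  IsNCmton : Set
  IsNCmton = Surj × NonCrossing × Monotonic

  Surj? : Dec Surj
  Surj? = all? λ x → any? λ i → f i ≟ x

  NonCrossing? : Dec NonCrossing
  NonCrossing? = all? λ a → all? λ p → all? λ c → all? λ q →
    (a <? p) →-dec (p <? c) →-dec (c <? q) →-dec
    (f a ≟ f c) →-dec (f p ≟ f q) →-dec (f a ≟ f p)

  IsMinOf? : ∀ x i → Dec (IsMinOf x i)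
  IsMinOf? x i = (f i ≟ x) ×-dec all? λ j → (f j ≟ x) →-dec (i ≤? j)

  IsMaxOf? : ∀ x i → Dec (IsMaxOf x i)
  IsMaxOf? x i = (f i ≟ x) ×-dec all? λ j → (f j ≟ x) →-dec (j ≤? i)

  NestedIn? : ∀ x y → Dec (NestedIn x y)
  NestedIn? x y = all? λ iV → all? λ iW → all? λ jV → all? λ jW →
    IsMinOf? x iV →-dec IsMinOf? y iW →-dec IsMaxOf? x jV →-dec
    IsMaxOf? y jW →-dec ((iW <? iV) ×-dec (jV <? jW))

  Monotonic? : Dec Monotonic
  Monotonic? = all? λ x → all? λ y → NestedIn? x y →-dec (y <? x)

  IsNCmton? : Dec IsNCmton
  IsNCmton? = Surj? ×-dec NonCrossing? ×-dec Monotonic?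

-- An element (π , u) of NC^(mton)(n).  The validity proof is irrelevant,
-- so elements are determined by (b , lab).
record NCm (n : ℕ) : Set where
  constructor ncm
  field
    blocks : ℕ
    lab    : Vec (Fin blocks) n
    .valid : IsNCmton (lookup lab)
open NCm public

labf : ∀ {n} (x : NCm n) → Fin n → Fin (blocks x)
labf x = lookup (lab x)

-- Enumeration of NC^(mton)(n) (every element occurs exactly once).

allVecs : ∀ {A : Set} (n : ℕ) → List A → List (Vec A n)
allVecs zero    xs = V.[] ∷ []
allVecs (suc n) xs = concatMap (λ a → L.map (a V.∷_) (allVecs n xs)) xs

keep : ∀ {n b} → Vec (Fin b) n → List (NCm n)
keep {n} {b} v with IsNCmton? (lookup v)
... | yes p = ncm b v p ∷ []
... | no _  = []

allNCm : (n : ℕ) → List (NCm n)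
allNCm n = concatMap (λ b → concatMap keep (allVecs n (allFin b))) (upTo (suc n))

-- J(π,u) = u⁻¹(|π|): positions whose label is the top label |π|.

InJ : ∀ {n} (x : NCm n) → Fin n → Set
InJ x i = suc (toℕ (labf x i)) ≡ blocks x

InJ? : ∀ {n} (x : NCm n) → ∀ i → Dec (InJ x i)
InJ? x i = suc (toℕ (labf x i)) ℕ.≟ blocks x

cardJ : ∀ {n} (x : NCm n) → ℕ
cardJ {n} x = length (filter (InJ? x) (allFin n))

IsMaxJ : ∀ {n} (x : NCm n) → Fin n → Set
IsMaxJ x m' = InJ x m' × (∀ i → InJ x i → i F.≤ m')

-- (ρ , v) = 𝔭(π , u), where m' = max J(π,u):  with φ = punchOut (the
-- increasing bijection {1..n}∖{m'} → {1..n-1}), every i ≠ m' lies in the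
-- block φ(V∖{m'}) of ρ whose v-label equals u(V), V the block of i.
-- (Together with surjectivity of the labelling of y, this says exactly
-- ρ = {φ(V∖{m'}) : V ≠ {m'}} and v(φ(V∖{m'})) = u(V).)
IsParent : ∀ {n} (x : NCm (suc n)) (m' : Fin (suc n)) (y : NCm n) → Set
IsParent {n} x m' y = ∀ (i : Fin (suc n)) (ne : m' ≢ i) →
  toℕ (labf y (punchOut ne)) ≡ toℕ (labf x i)

-- Z_n takes values in a type E with an addition _⊕_
-- (for the paper: E = ℝ, _⊕_ = +), and t^(·) is modelled by a map
-- pw : E → R into a commutative semiring with pw (a ⊕ b) ≈ pw a * pw b
-- (for the paper: R = ℝ, pw z = t^z with t > 0).

-- recursive of the first kind with input r = (r_1 , … , r_k)
-- (r j is r_{j+1} since Fin k = {0..k-1})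
RecursiveFirstKind : (E : Set) (_⊕_ : E → E → E) (k : ℕ) (r : Fin k → E)
                     (Z : (n : ℕ) → NCm n → E) → Set
RecursiveFirstKind E _⊕_ k r Z =
  ∀ (n : ℕ) → 1 ℕ.≤ n →                      -- the level n+1 ≥ 2
  ∀ (x : NCm (suc n)) (m' : Fin (suc n)) → IsMaxJ x m' →
  ∀ (y : NCm n) → IsParent x m' y →
    (∀ (j : Fin k) → suc (toℕ j) ≡ cardJ x → Z (suc n) x ≡ (Z n y ⊕ r j))
  × (k ℕ.< cardJ x → Z (suc n) x ≡ Z n y)

module _ {c ℓ : Level} (R : CommutativeSemiring c ℓ) where
  open CommutativeSemiring R

  sumR : ∀ {A : Set} → (A → Carrier) → List A → Carrier
  sumR g = foldr (λ a acc → g a + acc) 0#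

  timesℕ : ℕ → Carrier → Carrier
  timesℕ zero    a = 0#
  timesℕ (suc m) a = a + timesℕ m a

  Lpoly : {E : Set} (pw : E → Carrier) (Z : (n : ℕ) → NCm n → E) → ℕ → Carrier
  Lpoly pw Z n = sumR (λ x → pw (Z n x)) (allNCm n)

  LHS : {E : Set} (pw : E → Carrier) (Z : (n : ℕ) → NCm n → E) → ℕ → Carrier
  LHS pw Z m = sumR (λ x → pw (Z m x)) (filter (λ x → cardJ x ℕ.≟ 1) (allNCm m))

{-# OPTIONS --safe #-}
module Submission where

open import Defs
open import Level using (Level; 0ℓ)
open import Data.Nat as ℕ using (ℕ; zero; suc; _≤_; _∸_; s≤s; z≤n)
open import Data.Nat.Properties
  using (≤-trans; ≤-<-trans; <-asym; ≰⇒>; <⇒≱; 1+n≢0; 0≢1+n; suc-injective)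
open import Data.Fin as F using (Fin; fromℕ<; fromℕ; inject₁; punchIn; punchOut; toℕ)
open import Data.Fin.Properties
  using (_≟_; any?; fromℕ≢inject₁; inject₁-injective; inject₁ℕ<; toℕ-inject₁; toℕ-fromℕ;
         toℕ-fromℕ<; toℕ-injective; punchIn-punchOut; punchIn-mono-≤; punchIn-cancel-≤;
         <⇒≢; <-trans; ≤-reflexive)
open import Data.Fin.Relation.Unary.Top using (view; ‵fromℕ; ‵inject₁)
open import Data.Vec as V using (Vec; []; _∷_; lookup; insertAt)
open import Data.Vec.Properties using (insertAt-lookup; insertAt-punchIn; lookup-map)
open import Data.List as L
  using (List; []; _∷_; _++_; length; filter; tabulate; concatMap; applyUpTo)
open import Data.List.Properties using (foldr-map)
open import Data.Bool using (true; false; if_then_else_)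
open import Data.Product using (∃; _×_; _,_; proj₁; proj₂)
open import Data.Empty using (⊥-elim)
open import Function using (_∘_)
open import Function.Bundles using (_⇔_; mk⇔; module Equivalence)
open Equivalence using (to; from)
open import Relation.Binary.PropositionalEquality
  using (_≡_; _≢_; refl; sym; trans; cong; subst; ≢-sym; module ≡-Reasoning)
open import Relation.Nullary using (¬_; Dec; yes; no; does; contradiction)
open import Relation.Nullary.Decidable using (dec-true; dec-false; does-⇔)
open import Relation.Unary using (Pred; Decidable)
open import Algebra.Bundles using (CommutativeSemiring)

-- If |J(ρ,v)| = 1 then J = {p} is a singleton block carrying the largest label, p = max J, and
-- the parent of (ρ,v) is obtained by deleting it.  Conversely, a singleton block with a new
-- largest label may be inserted at any of the m positions of any element of NC^(mton)(m-1): a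
-- singleton crosses no block and has no block nested inside it, and with the largest label it may
-- lie inside any block.  So (p , parent) is a bijection from {(ρ,v) : |J(ρ,v)| = 1} onto
-- {1..m} × NC^(mton)(m-1) along which Z_m = Z_{m-1} + r_1, and each summand factors as
-- t^{r_1} t^{Z_{m-1}}.  On labellings: one with b+1 labels and exactly one top entry is
-- insertTop w p for a unique labelling w with b labels and a unique position p.

punchIn-mono-< : ∀ {n} (p : Fin (suc n)) (i j : Fin n) → i F.< j → punchIn p i F.< punchIn p j
punchIn-mono-< p i j i<j = ≰⇒> (λ pj≤pi → <⇒≱ i<j (punchIn-cancel-≤ p j i pj≤pi))

punchIn-cancel-< : ∀ {n} (p : Fin (suc n)) (i j : Fin n) → punchIn p i F.< punchIn p j → i F.< j
punchIn-cancel-< p i j pi<pj = ≰⇒> (λ j≤i → <⇒≱ pi<pj (punchIn-mono-≤ p j i j≤i))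

inject₁-mono-< : ∀ {n} {i j : Fin n} → i F.< j → inject₁ i F.< inject₁ j
inject₁-mono-< {i = i} {j} i<j rewrite toℕ-inject₁ i | toℕ-inject₁ j = i<j

inject₁-cancel-< : ∀ {n} {i j : Fin n} → inject₁ i F.< inject₁ j → i F.< j
inject₁-cancel-< {i = i} {j} i<j rewrite toℕ-inject₁ i | toℕ-inject₁ j = i<j

inject₁<fromℕ : ∀ {n} (i : Fin n) → inject₁ i F.< fromℕ n
inject₁<fromℕ {n} i = subst (toℕ (inject₁ i) ℕ.<_) (sym (toℕ-fromℕ n)) (inject₁ℕ< i)

IsMinOf-exists : ∀ {n b} (f : Fin n → Fin b) {x} → (∃ λ i → f i ≡ x) → ∃ (IsMinOf f x)
IsMinOf-exists {suc n} f {x} (i , fi≡x) with f F.zero ≟ x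
... | yes f0≡x = F.zero , f0≡x , λ _ _ → z≤n
... | no f0≢x with i
...   | F.zero  = contradiction fi≡x f0≢x
...   | F.suc i with IsMinOf-exists (f ∘ F.suc) (i , fi≡x)
...     | k , fk≡x , k-min = F.suc k , fk≡x , λ
          { F.zero    f0≡x → contradiction f0≡x f0≢x
          ; (F.suc j) fj≡x → s≤s (k-min j fj≡x) }

IsMaxOf-exists : ∀ {n b} (f : Fin n → Fin b) {x} → (∃ λ i → f i ≡ x) → ∃ (IsMaxOf f x)
IsMaxOf-exists {suc n} f {x} (i , fi≡x) with any? (λ j → f (F.suc j) ≟ x)
... | yes later with IsMaxOf-exists (f ∘ F.suc) later
...   | k , fk≡x , k-max = F.suc k , fk≡x , λ
        { F.zero    _    → z≤n
        ; (F.suc j) fj≡x → s≤s (k-max j fj≡x) }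
IsMaxOf-exists {suc n} f (F.zero , f0≡x) | no none-later = F.zero , f0≡x , λ
  { F.zero    _    → z≤n
  ; (F.suc j) fj≡x → contradiction (j , fj≡x) none-later }
IsMaxOf-exists {suc n} f (F.suc i , fi≡x) | no none-later = contradiction (i , fi≡x) none-later

¬NestedIn-singleton : ∀ {n b} (f : Fin n → Fin b) {x y s} → (∃ λ i → f i ≡ x) →
                      IsMinOf f y s → IsMaxOf f y s → ¬ NestedIn f x y
¬NestedIn-singleton f x≠∅ s-min s-max x⊂y
  with IsMinOf-exists f x≠∅ | IsMaxOf-exists f x≠∅
... | i , i-min | j , j-max with x⊂y i _ j _ i-min s-min j-max s-max
... | s<i , j<s = <-asym s<i (≤-<-trans (proj₂ i-min j (proj₁ j-max)) j<s)

insertTop : ∀ {n b} → Vec (Fin b) n → Fin (suc n) → Vec (Fin (suc b)) (suc n)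
insertTop {b = b} w p = insertAt (V.map inject₁ w) p (fromℕ b)

topCount : ∀ {n b} → Vec (Fin (suc b)) n → ℕ
topCount {b = b} = V.count (_≟ fromℕ b)

topCount-inject₁ : ∀ {n b} (a : Fin b) (v : Vec (Fin (suc b)) n) → topCount (inject₁ a ∷ v) ≡ topCount v
topCount-inject₁ {b = b} a v rewrite dec-false (inject₁ a ≟ fromℕ b) (fromℕ≢inject₁ ∘ sym) = refl

topCount-fromℕ : ∀ {n b} (v : Vec (Fin (suc b)) n) → topCount (fromℕ b ∷ v) ≡ suc (topCount v)
topCount-fromℕ {b = b} v rewrite dec-true (fromℕ b ≟ fromℕ b) refl = refl

topCount-map-inject₁ : ∀ {n b} (w : Vec (Fin b) n) → topCount (V.map inject₁ w) ≡ 0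
topCount-map-inject₁ []      = refl
topCount-map-inject₁ (a ∷ w) = trans (topCount-inject₁ a (V.map inject₁ w)) (topCount-map-inject₁ w)

topCount-insertTop : ∀ {n b} (w : Vec (Fin b) n) p → topCount (insertTop w p) ≡ 1
topCount-insertTop w       F.zero    =
  trans (topCount-fromℕ (V.map inject₁ w)) (cong suc (topCount-map-inject₁ w))
topCount-insertTop (a ∷ w) (F.suc p) =
  trans (topCount-inject₁ a (insertTop w p)) (topCount-insertTop w p)

length-filter-tabulate : ∀ {A B : Set} {P : Pred A 0ℓ} {Q : Pred B 0ℓ} (P? : Decidable P) (Q? : Decidable Q)
  {n} (f : Fin n → A) (v : Vec B n) → (∀ i → does (P? (f i)) ≡ does (Q? (lookup v i))) →
  length (filter P? (tabulate f)) ≡ V.count Q? v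
length-filter-tabulate P? Q? f []      _     = refl
length-filter-tabulate P? Q? f (y ∷ v) agree
  with does (P? (f F.zero)) | does (Q? y) | agree F.zero
... | true  | true  | _ = cong suc (length-filter-tabulate P? Q? (f ∘ F.suc) v (agree ∘ F.suc))
... | false | false | _ = length-filter-tabulate P? Q? (f ∘ F.suc) v (agree ∘ F.suc)

module _ {n b : ℕ} (v : Vec (Fin (suc b)) n) .(valid : IsNCmton (lookup v)) where

  InJ⇔top : ∀ i → InJ (ncm (suc b) v valid) i ⇔ (lookup v i ≡ fromℕ b)
  InJ⇔top i = mk⇔ (λ e → toℕ-injective (trans (suc-injective e) (sym (toℕ-fromℕ b))))
                  (λ e → cong suc (trans (cong toℕ e) (toℕ-fromℕ b)))

  cardJ≡topCount : cardJ (ncm (suc b) v valid) ≡ topCount v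
  cardJ≡topCount = length-filter-tabulate (InJ? (ncm (suc b) v valid)) (_≟ fromℕ b) (λ i → i) v
    (λ i → does-⇔ (InJ⇔top i) (InJ? (ncm (suc b) v valid) i) (lookup v i ≟ fromℕ b))

keep-valid : ∀ {n b} (v : Vec (Fin b) n) (valid : IsNCmton (lookup v)) → keep v ≡ ncm b v valid ∷ []
keep-valid v valid with IsNCmton? (lookup v)
... | yes _      = refl
... | no invalid = contradiction valid invalid

keep-invalid : ∀ {n b} (v : Vec (Fin b) n) → ¬ IsNCmton (lookup v) → keep v ≡ []
keep-invalid v invalid with IsNCmton? (lookup v)
... | yes valid = contradiction valid invalid
... | no _      = refl

module InsertTop {n b : ℕ} (w : Vec (Fin b) n) (p : Fin (suc n)) where

  f : Fin (suc n) → Fin (suc b)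
  f = lookup (insertTop w p)

  g : Fin n → Fin b
  g = lookup w

  f-at-p : f p ≡ fromℕ b
  f-at-p = insertAt-lookup (V.map inject₁ w) p (fromℕ b)

  f-punchIn : ∀ j → f (punchIn p j) ≡ inject₁ (g j)
  f-punchIn j = trans (insertAt-punchIn (V.map inject₁ w) p (fromℕ b) j) (lookup-map j inject₁ w)

  label⁺ : ∀ {j x} → g j ≡ x → f (punchIn p j) ≡ inject₁ x
  label⁺ {j} gj≡x = trans (f-punchIn j) (cong inject₁ gj≡x)

  label⁻ : ∀ {j x} → f (punchIn p j) ≡ inject₁ x → g j ≡ x
  label⁻ {j} e = inject₁-injective (trans (sym (f-punchIn j)) e)

  sameLabel⁺ : ∀ {i j} → g i ≡ g j → f (punchIn p i) ≡ f (punchIn p j)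
  sameLabel⁺ {j = j} gi≡gj = trans (label⁺ gi≡gj) (sym (f-punchIn j))

  sameLabel⁻ : ∀ {i j} → f (punchIn p i) ≡ f (punchIn p j) → g i ≡ g j
  sameLabel⁻ {j = j} e = label⁻ (trans e (f-punchIn j))

  top-fibre : ∀ {i} → f i ≡ fromℕ b → p ≡ i
  top-fibre {i} fi≡top with p ≟ i
  ... | yes p≡i = p≡i
  ... | no p≢i = contradiction
    (trans (sym fi≡top) (trans (cong f (sym (punchIn-punchOut p≢i))) (f-punchIn (punchOut p≢i))))
    fromℕ≢inject₁

  inject₁-fibre : ∀ {i x} → f i ≡ inject₁ x → ∃ λ j → punchIn p j ≡ i × g j ≡ x
  inject₁-fibre {i} fi≡x with p ≟ i
  ... | yes refl = contradiction (trans (sym f-at-p) fi≡x) fromℕ≢inject₁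
  ... | no p≢i = punchOut p≢i , punchIn-punchOut p≢i ,
                 label⁻ (trans (cong f (punchIn-punchOut p≢i)) fi≡x)

  sameBlock-punchIn : ∀ {i j} → i ≢ j → f i ≡ f j → ∃ λ i′ → punchIn p i′ ≡ i
  sameBlock-punchIn {i} {j} i≢j fi≡fj with p ≟ i
  ... | yes refl = contradiction (top-fibre (trans (sym fi≡fj) f-at-p)) i≢j
  ... | no p≢i = punchOut p≢i , punchIn-punchOut p≢i

  p-min : IsMinOf f (fromℕ b) p
  p-min = f-at-p , λ j fj≡top → ≤-reflexive (top-fibre fj≡top)

  p-max : IsMaxOf f (fromℕ b) p
  p-max = f-at-p , λ j fj≡top → ≤-reflexive (sym (top-fibre fj≡top))

  IsMinOf⁺ : ∀ {x i} → IsMinOf g x i → IsMinOf f (inject₁ x) (punchIn p i)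
  IsMinOf⁺ {x} {i} (gi≡x , i-min) = label⁺ gi≡x , lower
    where
    lower : ∀ j → f j ≡ inject₁ x → punchIn p i F.≤ j
    lower j fj≡x with inject₁-fibre fj≡x
    ... | j′ , refl , gj′≡x = punchIn-mono-≤ p i j′ (i-min j′ gj′≡x)

  IsMaxOf⁺ : ∀ {x i} → IsMaxOf g x i → IsMaxOf f (inject₁ x) (punchIn p i)
  IsMaxOf⁺ {x} {i} (gi≡x , i-max) = label⁺ gi≡x , upper
    where
    upper : ∀ j → f j ≡ inject₁ x → j F.≤ punchIn p i
    upper j fj≡x with inject₁-fibre fj≡x
    ... | j′ , refl , gj′≡x = punchIn-mono-≤ p j′ i (i-max j′ gj′≡x)

  IsMinOf⁻ : ∀ {x i} → IsMinOf f (inject₁ x) (punchIn p i) → IsMinOf g x i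
  IsMinOf⁻ {i = i} (fi≡x , i-min) =
    label⁻ fi≡x , λ j gj≡x → punchIn-cancel-≤ p i j (i-min (punchIn p j) (label⁺ gj≡x))

  IsMaxOf⁻ : ∀ {x i} → IsMaxOf f (inject₁ x) (punchIn p i) → IsMaxOf g x i
  IsMaxOf⁻ {i = i} (fi≡x , i-max) =
    label⁻ fi≡x , λ j gj≡x → punchIn-cancel-≤ p j i (i-max (punchIn p j) (label⁺ gj≡x))

  NestedIn⁺ : ∀ {x y} → NestedIn g x y → NestedIn f (inject₁ x) (inject₁ y)
  NestedIn⁺ x⊂y iV iW jV jW iV-min iW-min jV-max jW-max
    with inject₁-fibre (proj₁ iV-min) | inject₁-fibre (proj₁ iW-min)
       | inject₁-fibre (proj₁ jV-max) | inject₁-fibre (proj₁ jW-max)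
  ... | iV′ , refl , _ | iW′ , refl , _ | jV′ , refl , _ | jW′ , refl , _
    with x⊂y iV′ iW′ jV′ jW′ (IsMinOf⁻ iV-min) (IsMinOf⁻ iW-min) (IsMaxOf⁻ jV-max) (IsMaxOf⁻ jW-max)
  ... | iW<iV , jV<jW = punchIn-mono-< p iW′ iV′ iW<iV , punchIn-mono-< p jV′ jW′ jV<jW

  NestedIn⁻ : ∀ {x y} → NestedIn f (inject₁ x) (inject₁ y) → NestedIn g x y
  NestedIn⁻ x⊂y iV iW jV jW iV-min iW-min jV-max jW-max
    with x⊂y (punchIn p iV) (punchIn p iW) (punchIn p jV) (punchIn p jW)
             (IsMinOf⁺ iV-min) (IsMinOf⁺ iW-min) (IsMaxOf⁺ jV-max) (IsMaxOf⁺ jW-max)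
  ... | iW<iV , jV<jW = punchIn-cancel-< p iW iV iW<iV , punchIn-cancel-< p jV jW jV<jW

  Surj⁺ : Surj g → Surj f
  Surj⁺ surj x with view x
  ... | ‵fromℕ      = p , f-at-p
  ... | ‵inject₁ x′ with surj x′
  ...   | j , gj≡x′ = punchIn p j , label⁺ gj≡x′

  Surj⁻ : Surj f → Surj g
  Surj⁻ surj x with inject₁-fibre (proj₂ (surj (inject₁ x)))
  ... | j , _ , gj≡x = j , gj≡x

  NonCrossing⁺ : NonCrossing g → NonCrossing f
  NonCrossing⁺ nc a q c s a<q q<c c<s fa≡fc fq≡fs
    with sameBlock-punchIn (<⇒≢ a<c) fa≡fc | sameBlock-punchIn (≢-sym (<⇒≢ a<c)) (sym fa≡fc)
       | sameBlock-punchIn (<⇒≢ q<s) fq≡fs | sameBlock-punchIn (≢-sym (<⇒≢ q<s)) (sym fq≡fs)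
    where
    a<c : a F.< c
    a<c = <-trans a<q q<c
    q<s : q F.< s
    q<s = <-trans q<c c<s
  ... | a′ , refl | c′ , refl | q′ , refl | s′ , refl = sameLabel⁺
    (nc a′ q′ c′ s′ (punchIn-cancel-< p a′ q′ a<q) (punchIn-cancel-< p q′ c′ q<c)
        (punchIn-cancel-< p c′ s′ c<s) (sameLabel⁻ fa≡fc) (sameLabel⁻ fq≡fs))

  NonCrossing⁻ : NonCrossing f → NonCrossing g
  NonCrossing⁻ nc a q c s a<q q<c c<s ga≡gc gq≡gs = sameLabel⁻
    (nc (punchIn p a) (punchIn p q) (punchIn p c) (punchIn p s)
        (punchIn-mono-< p a q a<q) (punchIn-mono-< p q c q<c) (punchIn-mono-< p c s c<s)
        (sameLabel⁺ ga≡gc) (sameLabel⁺ gq≡gs))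

  Monotonic⁺ : Surj f → Monotonic g → Monotonic f
  Monotonic⁺ surj mono x y x⊂y with view y
  ... | ‵fromℕ = ⊥-elim (¬NestedIn-singleton f (surj x) p-min p-max x⊂y)
  ... | ‵inject₁ y′ with view x
  ...   | ‵fromℕ      = inject₁<fromℕ y′
  ...   | ‵inject₁ x′ = inject₁-mono-< (mono x′ y′ (NestedIn⁻ x⊂y))

  Monotonic⁻ : Monotonic f → Monotonic g
  Monotonic⁻ mono x y x⊂y = inject₁-cancel-< (mono (inject₁ x) (inject₁ y) (NestedIn⁺ x⊂y))

  IsNCmton⁺ : IsNCmton g → IsNCmton f
  IsNCmton⁺ (surj , nc , mono) = Surj⁺ surj , NonCrossing⁺ nc , Monotonic⁺ (Surj⁺ surj) mono

  IsNCmton⁻ : IsNCmton f → IsNCmton g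
  IsNCmton⁻ (surj , nc , mono) = Surj⁻ surj , NonCrossing⁻ nc , Monotonic⁻ mono

  inserted : .(IsNCmton g) → NCm (suc n)
  inserted valid = ncm (suc b) (insertTop w p) (IsNCmton⁺ valid)

  module _ .(valid : IsNCmton g) where

    cardJ-inserted : cardJ (inserted valid) ≡ 1
    cardJ-inserted = trans (cardJ≡topCount (insertTop w p) (IsNCmton⁺ valid)) (topCount-insertTop w p)

    IsMaxJ-inserted : IsMaxJ (inserted valid) p
    IsMaxJ-inserted = from (InJ⇔top (insertTop w p) (IsNCmton⁺ valid) p) f-at-p , below-p
      where
      below-p : ∀ i → InJ (inserted valid) i → i F.≤ p
      below-p i i∈J = ≤-reflexive (sym (top-fibre (to (InJ⇔top (insertTop w p) (IsNCmton⁺ valid) i) i∈J)))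

    IsParent-inserted : IsParent (inserted valid) p (ncm b w valid)
    IsParent-inserted i p≢i = begin
      toℕ (g (punchOut p≢i))                 ≡⟨ toℕ-inject₁ _ ⟨
      toℕ (inject₁ (g (punchOut p≢i)))       ≡⟨ cong toℕ (f-punchIn (punchOut p≢i)) ⟨
      toℕ (f (punchIn p (punchOut p≢i)))     ≡⟨ cong (toℕ ∘ f) (punchIn-punchOut p≢i) ⟩
      toℕ (f i)                              ∎
      where open ≡-Reasoning

module _ {E : Set} (_⊕_ : E → E → E) {k : ℕ} (r : Fin k → E) {Z : (n : ℕ) → NCm n → E}
         (rfk : RecursiveFirstKind E _⊕_ k r Z) where

  Z-inserted : ∀ {n b} → 1 ≤ n → .(0<k : 0 ℕ.< k) (w : Vec (Fin b) n) (p : Fin (suc n))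
               .(valid : IsNCmton (lookup w)) →
               Z (suc n) (InsertTop.inserted w p valid) ≡ (Z n (ncm b w valid) ⊕ r (fromℕ< 0<k))
  Z-inserted 1≤n 0<k w p valid =
    proj₁ (rfk _ 1≤n _ p (IsMaxJ-inserted valid) _ (IsParent-inserted valid)) (fromℕ< 0<k)
          (trans (cong suc (toℕ-fromℕ< 0<k)) (sym (cardJ-inserted valid)))
    where open InsertTop w p

module Sums {c ℓ : Level} (R : CommutativeSemiring c ℓ) where
  open CommutativeSemiring R
    renaming (refl to ≈-refl; sym to ≈-sym; trans to ≈-trans) hiding (zero)
  open import Algebra.Properties.Semiring.Sum semiring
  open import Relation.Binary.Reasoning.Setoid setoid

  module _ {A : Set} where

    sumR-cong : ∀ {g h : A → Carrier} (xs : List A) → (∀ x → g x ≈ h x) → sumR R g xs ≈ sumR R h xs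
    sumR-cong []       g≈h = ≈-refl
    sumR-cong (x ∷ xs) g≈h = +-cong (g≈h x) (sumR-cong xs g≈h)

    sumR-++ : ∀ (g : A → Carrier) xs ys → sumR R g (xs ++ ys) ≈ sumR R g xs + sumR R g ys
    sumR-++ g []       ys = ≈-sym (+-identityˡ _)
    sumR-++ g (x ∷ xs) ys = ≈-trans (+-congˡ (sumR-++ g xs ys)) (≈-sym (+-assoc _ _ _))

    sumR-filter : ∀ {P : Pred A 0ℓ} (P? : Decidable P) (g : A → Carrier) xs →
                  sumR R g (filter P? xs) ≈ sumR R (λ x → if does (P? x) then g x else 0#) xs
    sumR-filter P? g []       = ≈-refl
    sumR-filter P? g (x ∷ xs) with does (P? x)
    ... | true  = +-congˡ (sumR-filter P? g xs)
    ... | false = ≈-trans (sumR-filter P? g xs) (≈-sym (+-identityˡ _))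

    sumR-tabulate : ∀ (g : A → Carrier) {n} (f : Fin n → A) → sumR R g (tabulate f) ≈ ∑[ i < n ] g (f i)
    sumR-tabulate g {zero}  f = ≈-refl
    sumR-tabulate g {suc n} f = +-congˡ (sumR-tabulate g (f ∘ F.suc))

    sumR-applyUpTo : ∀ (g : A → Carrier) (f : ℕ → A) n → sumR R g (applyUpTo f n) ≈ ∑[ i < n ] g (f (toℕ i))
    sumR-applyUpTo g f zero    = ≈-refl
    sumR-applyUpTo g f (suc n) = +-congˡ (sumR-applyUpTo g (f ∘ suc) n)

  sumR-concatMap : ∀ {A B : Set} (g : B → Carrier) (f : A → List B) xs →
                   sumR R g (concatMap f xs) ≈ sumR R (λ a → sumR R g (f a)) xs
  sumR-concatMap g f []       = ≈-refl
  sumR-concatMap g f (x ∷ xs) = ≈-trans (sumR-++ g (f x) (concatMap f xs)) (+-congˡ (sumR-concatMap g f xs))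

  sumR-map : ∀ {A B : Set} (g : B → Carrier) (f : A → B) xs → sumR R g (L.map f xs) ≡ sumR R (g ∘ f) xs
  sumR-map g f = foldr-map _ f 0#

  ∑ᵛ : ∀ n b → (Vec (Fin b) n → Carrier) → Carrier
  ∑ᵛ zero    b G = G []
  ∑ᵛ (suc n) b G = ∑[ a < b ] ∑ᵛ n b (λ v → G (a ∷ v))

  ∑ᵛ-cong : ∀ n b {G H : Vec (Fin b) n → Carrier} → (∀ v → G v ≈ H v) → ∑ᵛ n b G ≈ ∑ᵛ n b H
  ∑ᵛ-cong zero    b G≈H = G≈H []
  ∑ᵛ-cong (suc n) b G≈H = sum-cong-≋ {b} (λ a → ∑ᵛ-cong n b (λ v → G≈H (a ∷ v)))

  ∑ᵛ-vanishes : ∀ n b {G : Vec (Fin b) n → Carrier} → (∀ v → G v ≈ 0#) → ∑ᵛ n b G ≈ 0#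
  ∑ᵛ-vanishes zero    b G≈0 = G≈0 []
  ∑ᵛ-vanishes (suc n) b G≈0 =
    ≈-trans (sum-cong-≋ {b} (λ a → ∑ᵛ-vanishes n b (λ v → G≈0 (a ∷ v)))) (sum-replicate-zero b)

  *-distribˡ-∑ᵛ : ∀ n b x (G : Vec (Fin b) n → Carrier) → x * ∑ᵛ n b G ≈ ∑ᵛ n b (λ v → x * G v)
  *-distribˡ-∑ᵛ zero    b x G = ≈-refl
  *-distribˡ-∑ᵛ (suc n) b x G =
    ≈-trans (*-distribˡ-sum x (λ a → ∑ᵛ n b (λ v → G (a ∷ v))))
            (sum-cong-≋ {b} (λ a → *-distribˡ-∑ᵛ n b x (λ v → G (a ∷ v))))

  sumR-allVecs : ∀ n b (G : Vec (Fin b) n → Carrier) → sumR R G (allVecs n (L.allFin b)) ≈ ∑ᵛ n b G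
  sumR-allVecs zero    b G = +-identityʳ _
  sumR-allVecs (suc n) b G = begin
    sumR R G (concatMap (λ a → L.map (a ∷_) (allVecs n (L.allFin b))) (L.allFin b))
      ≈⟨ sumR-concatMap G (λ a → L.map (a ∷_) (allVecs n (L.allFin b))) (L.allFin b) ⟩
    sumR R (λ a → sumR R G (L.map (a ∷_) (allVecs n (L.allFin b)))) (L.allFin b)
      ≈⟨ sumR-cong (L.allFin b) (λ a → ≈-trans (reflexive (sumR-map G (a ∷_) (allVecs n (L.allFin b))))
                                               (sumR-allVecs n b (λ v → G (a ∷ v)))) ⟩
    sumR R (λ a → ∑ᵛ n b (λ v → G (a ∷ v))) (L.allFin b)
      ≈⟨ sumR-tabulate (λ a → ∑ᵛ n b (λ v → G (a ∷ v))) (λ a → a) ⟩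
    ∑ᵛ (suc n) b G ∎

  sumR-allNCm : ∀ n (h : NCm n → Carrier) →
                sumR R h (allNCm n) ≈ ∑[ b < suc n ] ∑ᵛ n (toℕ b) (λ v → sumR R h (keep v))
  sumR-allNCm n h = begin
    sumR R h (concatMap (λ b → concatMap keep (allVecs n (L.allFin b))) (L.upTo (suc n)))
      ≈⟨ sumR-concatMap h (λ b → concatMap keep (allVecs n (L.allFin b))) (L.upTo (suc n)) ⟩
    sumR R (λ b → sumR R h (concatMap keep (allVecs n (L.allFin b)))) (L.upTo (suc n))
      ≈⟨ sumR-cong (L.upTo (suc n)) (λ b → ≈-trans (sumR-concatMap h keep (allVecs n (L.allFin b)))
                                                   (sumR-allVecs n b (λ v → sumR R h (keep v)))) ⟩
    sumR R (λ b → ∑ᵛ n b (λ v → sumR R h (keep v))) (L.upTo (suc n))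
      ≈⟨ sumR-applyUpTo (λ b → ∑ᵛ n b (λ v → sumR R h (keep v))) (λ b → b) (suc n) ⟩
    ∑[ b < suc n ] ∑ᵛ n (toℕ b) (λ v → sumR R h (keep v)) ∎

  timesℕ≈∑ : ∀ m x → timesℕ R m x ≈ ∑[ _ < m ] x
  timesℕ≈∑ zero    x = ≈-refl
  timesℕ≈∑ (suc m) x = +-congˡ (timesℕ≈∑ m x)

  SupportedOnTopCount : ∀ {n b} → ℕ → (Vec (Fin (suc b)) n → Carrier) → Set ℓ
  SupportedOnTopCount t G = ∀ v → topCount v ≢ t → G v ≈ 0#

  module _ {n b} {G : Vec (Fin (suc b)) (suc n) → Carrier} where

    supported-inject₁ : ∀ {t} → SupportedOnTopCount t G → ∀ a → SupportedOnTopCount t (λ v → G (inject₁ a ∷ v))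
    supported-inject₁ G-supp a v c≢t = G-supp (inject₁ a ∷ v) (c≢t ∘ trans (sym (topCount-inject₁ a v)))

    supported-fromℕ : ∀ {t} → SupportedOnTopCount (suc t) G → SupportedOnTopCount t (λ v → G (fromℕ b ∷ v))
    supported-fromℕ G-supp v c≢t = G-supp (fromℕ b ∷ v) (c≢t ∘ suc-injective ∘ trans (sym (topCount-fromℕ v)))

  ∑ᵛ-topFree : ∀ n b (G : Vec (Fin (suc b)) n → Carrier) → SupportedOnTopCount 0 G →
               ∑ᵛ n (suc b) G ≈ ∑ᵛ n b (λ w → G (V.map inject₁ w))
  ∑ᵛ-topFree zero    b G G-supp = ≈-refl
  ∑ᵛ-topFree (suc n) b G G-supp = begin
    ∑[ a < suc b ] ∑ᵛ n (suc b) (λ v → G (a ∷ v))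
      ≈⟨ sum-init-last (λ a → ∑ᵛ n (suc b) (λ v → G (a ∷ v))) ⟩
    ∑[ a < b ] ∑ᵛ n (suc b) (λ v → G (inject₁ a ∷ v)) + ∑ᵛ n (suc b) (λ v → G (fromℕ b ∷ v))
      ≈⟨ +-cong (sum-cong-≋ {b} (λ a → ∑ᵛ-topFree n b _ (supported-inject₁ G-supp a)))
                (∑ᵛ-vanishes n (suc b) (λ v → G-supp (fromℕ b ∷ v) (1+n≢0 ∘ trans (sym (topCount-fromℕ v))))) ⟩
    ∑ᵛ (suc n) b (λ w → G (V.map inject₁ w)) + 0#
      ≈⟨ +-identityʳ _ ⟩
    ∑ᵛ (suc n) b (λ w → G (V.map inject₁ w)) ∎

  ∑ᵛ-singleTop : ∀ n b (G : Vec (Fin (suc b)) (suc n) → Carrier) → SupportedOnTopCount 1 G →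
                 ∑ᵛ (suc n) (suc b) G ≈ ∑[ p < suc n ] ∑ᵛ n b (λ w → G (insertTop w p))
  ∑ᵛ-singleTop-below : ∀ n b (G : Vec (Fin (suc b)) (suc n) → Carrier) → SupportedOnTopCount 1 G →
                       ∑[ a < b ] ∑ᵛ n (suc b) (λ v → G (inject₁ a ∷ v))
                         ≈ ∑[ p < n ] ∑ᵛ n b (λ w → G (insertTop w (F.suc p)))

  ∑ᵛ-singleTop n b G G-supp = begin
    ∑[ a < suc b ] ∑ᵛ n (suc b) (λ v → G (a ∷ v))
      ≈⟨ sum-init-last (λ a → ∑ᵛ n (suc b) (λ v → G (a ∷ v))) ⟩
    ∑[ a < b ] ∑ᵛ n (suc b) (λ v → G (inject₁ a ∷ v)) + ∑ᵛ n (suc b) (λ v → G (fromℕ b ∷ v))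
      ≈⟨ +-comm _ _ ⟩
    ∑ᵛ n (suc b) (λ v → G (fromℕ b ∷ v)) + ∑[ a < b ] ∑ᵛ n (suc b) (λ v → G (inject₁ a ∷ v))
      ≈⟨ +-cong (∑ᵛ-topFree n b _ (supported-fromℕ G-supp)) (∑ᵛ-singleTop-below n b G G-supp) ⟩
    ∑[ p < suc n ] ∑ᵛ n b (λ w → G (insertTop w p)) ∎

  ∑ᵛ-singleTop-below zero    b G G-supp =
    ∑ᵛ-vanishes 1 b (λ v → G-supp (V.map inject₁ v) (0≢1+n ∘ trans (sym (topCount-map-inject₁ v))))
  ∑ᵛ-singleTop-below (suc n) b G G-supp = begin
    ∑[ a < b ] ∑ᵛ (suc n) (suc b) (λ v → G (inject₁ a ∷ v))
      ≈⟨ sum-cong-≋ {b} (λ a → ∑ᵛ-singleTop n b _ (supported-inject₁ G-supp a)) ⟩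
    ∑[ a < b ] ∑[ p < suc n ] ∑ᵛ n b (λ w → G (inject₁ a ∷ insertTop w p))
      ≈⟨ ∑-comm (λ a p → ∑ᵛ n b (λ w → G (inject₁ a ∷ insertTop w p))) ⟩
    ∑[ p < suc n ] ∑ᵛ (suc n) b (λ w → G (insertTop w (F.suc p))) ∎

module FirstKind {c ℓ : Level} (R : CommutativeSemiring c ℓ) {E : Set} {_⊕_ : E → E → E}
  (pw : E → CommutativeSemiring.Carrier R)
  (pw-hom : ∀ a b → CommutativeSemiring._≈_ R (pw (a ⊕ b)) (CommutativeSemiring._*_ R (pw a) (pw b)))
  {k : ℕ} (r : Fin k → E) .(0<k : 0 ℕ.< k) {Z : (n : ℕ) → NCm n → E}
  (rfk : RecursiveFirstKind E _⊕_ k r Z) {n : ℕ} (1≤n : 1 ≤ n) where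

  open CommutativeSemiring R
    renaming (refl to ≈-refl; sym to ≈-sym; trans to ≈-trans) hiding (zero)
  open Sums R
  open import Algebra.Properties.Semiring.Sum semiring
  open import Relation.Binary.Reasoning.Setoid setoid

  r₁ : E
  r₁ = r (fromℕ< 0<k)

  weight : NCm n → Carrier
  weight y = pw (Z n y)

  singleTopWeight : NCm (suc n) → Carrier
  singleTopWeight x = if does (cardJ x ℕ.≟ 1) then pw (Z (suc n) x) else 0#

  singleTopWeight-supported : ∀ {b} → SupportedOnTopCount {suc n} {b} 1 (λ v → sumR R singleTopWeight (keep v))
  singleTopWeight-supported v c≢1 with IsNCmton? (lookup v)
  ... | no _      = ≈-refl
  ... | yes valid = begin
    singleTopWeight (ncm _ v valid) + 0#
      ≈⟨ +-identityʳ _ ⟩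
    singleTopWeight (ncm _ v valid)
      ≡⟨ cong (λ t → if t then pw (Z (suc n) (ncm _ v valid)) else 0#)
              (dec-false (cardJ (ncm _ v valid) ℕ.≟ 1) (c≢1 ∘ trans (sym (cardJ≡topCount v valid)))) ⟩
    0# ∎

  singleTopWeight-inserted : ∀ {b} (w : Vec (Fin b) n) p →
    sumR R singleTopWeight (keep (insertTop w p)) ≈ pw r₁ * sumR R weight (keep w)
  singleTopWeight-inserted {b} w p = by-validity (IsNCmton? (lookup w))
    where
    open InsertTop w p

    by-validity : Dec (IsNCmton g) →
                  sumR R singleTopWeight (keep (insertTop w p)) ≈ pw r₁ * sumR R weight (keep w)
    by-validity (no invalid) = begin
      sumR R singleTopWeight (keep (insertTop w p))
        ≡⟨ cong (sumR R singleTopWeight) (keep-invalid (insertTop w p) (invalid ∘ IsNCmton⁻)) ⟩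
      0#
        ≈⟨ zeroʳ (pw r₁) ⟨
      pw r₁ * 0#
        ≡⟨ cong (λ ys → pw r₁ * sumR R weight ys) (keep-invalid w invalid) ⟨
      pw r₁ * sumR R weight (keep w) ∎
    by-validity (yes valid) = begin
      sumR R singleTopWeight (keep (insertTop w p))
        ≡⟨ cong (sumR R singleTopWeight) (keep-valid (insertTop w p) (IsNCmton⁺ valid)) ⟩
      singleTopWeight (inserted valid) + 0#
        ≈⟨ +-identityʳ _ ⟩
      singleTopWeight (inserted valid)
        ≡⟨ cong (λ t → if t then pw (Z (suc n) (inserted valid)) else 0#)
                (dec-true (cardJ (inserted valid) ℕ.≟ 1) (cardJ-inserted valid)) ⟩
      pw (Z (suc n) (inserted valid))
        ≡⟨ cong pw (Z-inserted _⊕_ r rfk 1≤n 0<k w p valid) ⟩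
      pw (Z n (ncm b w valid) ⊕ r₁)
        ≈⟨ pw-hom _ _ ⟩
      weight (ncm b w valid) * pw r₁
        ≈⟨ *-comm _ _ ⟩
      pw r₁ * weight (ncm b w valid)
        ≈⟨ *-congˡ (+-identityʳ _) ⟨
      pw r₁ * sumR R weight (ncm b w valid ∷ [])
        ≡⟨ cong (λ ys → pw r₁ * sumR R weight ys) (keep-valid w valid) ⟨
      pw r₁ * sumR R weight (keep w) ∎

  ∑ᵛ-singleTopWeight : ∀ b →
    ∑ᵛ (suc n) (suc b) (λ v → sumR R singleTopWeight (keep v))
      ≈ ∑[ _ < suc n ] (pw r₁ * ∑ᵛ n b (λ w → sumR R weight (keep w)))
  ∑ᵛ-singleTopWeight b = begin
    ∑ᵛ (suc n) (suc b) (λ v → sumR R singleTopWeight (keep v))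
      ≈⟨ ∑ᵛ-singleTop n b _ singleTopWeight-supported ⟩
    ∑[ p < suc n ] ∑ᵛ n b (λ w → sumR R singleTopWeight (keep (insertTop w p)))
      ≈⟨ sum-cong-≋ {suc n} (λ p → ∑ᵛ-cong n b (λ w → singleTopWeight-inserted w p)) ⟩
    ∑[ p < suc n ] ∑ᵛ n b (λ w → pw r₁ * sumR R weight (keep w))
      ≈⟨ sum-cong-≋ {suc n} (λ _ → *-distribˡ-∑ᵛ n b (pw r₁) (λ w → sumR R weight (keep w))) ⟨
    ∑[ _ < suc n ] (pw r₁ * ∑ᵛ n b (λ w → sumR R weight (keep w))) ∎

lemma3p4 : ∀ {c ℓ : Level} (R : CommutativeSemiring c ℓ)
    (E : Set) (_⊕_ : E → E → E)
    (pw : E → CommutativeSemiring.Carrier R)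
    (pw-hom : ∀ a b → CommutativeSemiring._≈_ R (pw (a ⊕ b)) (CommutativeSemiring._*_ R (pw a) (pw b)))
    (k : ℕ) (hk : 2 ≤ k) (r : Fin k → E)
    (Z : (n : ℕ) → NCm n → E) → RecursiveFirstKind E _⊕_ k r Z →
    ∀ (m : ℕ) → 2 ≤ m →
    CommutativeSemiring._≈_ R (LHS R pw Z m)
      (timesℕ R m (CommutativeSemiring._*_ R (pw (r (fromℕ< (≤-trans (s≤s z≤n) hk)))) (Lpoly R pw Z (m ∸ 1))))
lemma3p4 R E _⊕_ pw pw-hom k hk r Z rfk (suc n) (s≤s 1≤n) = begin
  LHS R pw Z (suc n)
    ≈⟨ sumR-filter (λ x → cardJ x ℕ.≟ 1) (pw ∘ Z (suc n)) (allNCm (suc n)) ⟩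
  sumR R singleTopWeight (allNCm (suc n))
    ≈⟨ sumR-allNCm (suc n) singleTopWeight ⟩
  ∑[ b < suc (suc n) ] ∑ᵛ (suc n) (toℕ b) (λ v → sumR R singleTopWeight (keep v))
    ≈⟨ +-identityˡ _ ⟩  -- a nonempty set has no labelling with 0 labels
  ∑[ b < suc n ] ∑ᵛ (suc n) (suc (toℕ b)) (λ v → sumR R singleTopWeight (keep v))
    ≈⟨ sum-cong-≋ {suc n} (λ b → ∑ᵛ-singleTopWeight (toℕ b)) ⟩
  ∑[ b < suc n ] ∑[ _ < suc n ] (pw r₁ * L b)
    ≈⟨ ∑-comm {suc n} {suc n} (λ b _ → pw r₁ * L b) ⟩
  ∑[ _ < suc n ] ∑[ b < suc n ] (pw r₁ * L b)
    ≈⟨ sum-cong-≋ {suc n} (λ _ → *-distribˡ-sum (pw r₁) L) ⟨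
  ∑[ _ < suc n ] (pw r₁ * ∑[ b < suc n ] L b)
    ≈⟨ sum-cong-≋ {suc n} (λ _ → *-congˡ {pw r₁} (sumR-allNCm n weight)) ⟨
  ∑[ _ < suc n ] (pw r₁ * Lpoly R pw Z n)
    ≈⟨ timesℕ≈∑ (suc n) _ ⟨
  timesℕ R (suc n) (pw r₁ * Lpoly R pw Z n) ∎
  where
  open CommutativeSemiring R using (_*_; +-identityˡ; *-congˡ; semiring; setoid)
  open Sums R
  open FirstKind R pw pw-hom r (≤-trans (s≤s z≤n) hk) rfk 1≤n
  open import Algebra.Properties.Semiring.Sum semiring
  open import Relation.Binary.Reasoning.Setoid setoid

  L : Fin (suc n) → CommutativeSemiring.Carrier R
  L b = ∑ᵛ n (toℕ b) (λ w → sumR R weight (keep w))
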